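{- A diamond-free graph $G=(V,E)$ has at most $|E|$ maximal cliques.
   Context: Graphs are finite and simple. The diamond is $K_4$ minus an edge; diamond-free means no induced diamond. Maximal clique means inclusion-maximal clique.
   Formalization: The graph G is also assumed to have no isolated vertex, every vertex having a neighbour. The statement above fails without it. -}

module Defs where

open import Data.Nat using (ℕ; _<_)
open import Data.Fin using (Fin; toℕ)
open import Data.Bool using (Bool; true; false)
open import Data.Fin.Subset using (Subset; _∈_; _⊆_; Nonempty)
open import Data.List using (List; length; filter; allFin; concatMap; map)
open import Data.List.Relation.Unary.All using (All)
open import Data.List.Relation.Unary.Unique.Propositional using (Unique)
open import Data.Product using (Σ; _×_; _,_; ∃)
open import Relation.Binary.PropositionalEquality using (_≡_; _≢_)
open import Relation.Nullary using (¬_)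
open import Data.Bool using (T)
open import Data.Nat using (_<ᵇ_)
open import Data.Bool using (_∧_)

record Graph (n : ℕ) : Set where
  field
    adj     : Fin n → Fin n → Bool
    symm    : ∀ i j → adj i j ≡ adj j i
    irrefl  : ∀ i → adj i i ≡ false

open Graph public

Adj : ∀ {n} → Graph n → Fin n → Fin n → Set
Adj G i j = adj G i j ≡ true

edgeCount : ∀ {n} → Graph n → ℕ
edgeCount {n} G =
  length (filter (λ p → Data.Bool._≟_ (edgeB p) true)
                 (concatMap (λ i → map (λ j → i , j) (allFin n)) (allFin n)))
  where
    open import Data.Product using (proj₁; proj₂)
    edgeB : Fin n × Fin n → Bool
    edgeB (i , j) = (toℕ i <ᵇ toℕ j) ∧ adj G i j

IsClique : ∀ {n} → Graph n → Subset n → Set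
IsClique G S = Nonempty S × (∀ i j → i ∈ S → j ∈ S → i ≢ j → Adj G i j)

IsMaximalClique : ∀ {n} → Graph n → Subset n → Set
IsMaximalClique G S = IsClique G S × (∀ T → IsClique G T → S ⊆ T → T ⊆ S)

InducedDiamond : ∀ {n} → Graph n → Fin n → Fin n → Fin n → Fin n → Set
InducedDiamond G a b c d =
  a ≢ b × a ≢ c × a ≢ d × b ≢ c × b ≢ d × c ≢ d ×
  Adj G a b × Adj G a c × Adj G a d × Adj G b c × Adj G b d × ¬ Adj G c d

DiamondFree : ∀ {n} → Graph n → Set
DiamondFree G = ∀ a b c d → ¬ InducedDiamond G a b c d

NoIsolatedVertex : ∀ {n} → Graph n → Set
NoIsolatedVertex {n} G = ∀ i → ∃ λ (j : Fin n) → Adj G i j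

{-# OPTIONS --safe #-}
module Submission where

open import Defs
open import Data.Bool using (true; _∧_)
import Data.Bool as Bool
open import Data.Bool.Properties using (T-≡; T-∧)
open import Data.Empty using (⊥-elim)
open import Data.Fin using (Fin; toℕ)
open import Data.Fin.Properties using (toℕ-injective; any?) renaming (_≟_ to _≟ᶠ_)
open import Data.Fin.Subset using (Subset; _∈_; _∉_; _⊆_; _∪_; ⁅_⁆)
open import Data.Fin.Subset.Properties
  using (_∈?_; x∈⁅x⁆; x∈⁅y⁆⇒x≡y; p⊆p∪q; q⊆p∪q; x∈p∪q⁻; x∈p∪q⁺; ⊆-antisym)
open import Data.List using (List; _∷_; length; filter; allFin; concatMap; map)
open import Data.List.Properties using (length-removeAt′)
open import Data.List.Relation.Unary.All using (All; []; _∷_)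
import Data.List.Relation.Unary.All as All
open import Data.List.Relation.Unary.AllPairs using ([]; _∷_)
open import Data.List.Relation.Unary.Any using (Any; here; there; index; _─_)
import Data.List.Relation.Unary.Any as Any
open import Data.List.Relation.Unary.Unique.Propositional using (Unique)
open import Data.List.Membership.Propositional using (lose) renaming (_∈_ to _∈ˡ_)
open import Data.List.Membership.Propositional.Properties
  using (∈-filter⁺; ∈-concatMap⁺; ∈-map⁺; ∈-allFin)
open import Data.Nat using (suc; _≤_; _<_; _<ᵇ_; z≤n; s≤s)
open import Data.Nat.Properties using (<-cmp; <⇒<ᵇ; module ≤-Reasoning)
open import Data.Product using (_×_; _,_; ∃₂; proj₁; proj₂)
open import Data.Sum using (_⊎_; inj₁; inj₂)
open import Function.Bundles using (Equivalence)
open import Relation.Binary.Definitions using (tri<; tri≈; tri>)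
open import Relation.Binary.PropositionalEquality using (_≡_; _≢_; refl; sym; trans; ≢-sym)
open import Relation.Nullary using (Dec; yes; no)
open import Relation.Nullary.Decidable using (decidable-stable; _×-dec_; ¬?)

-- If two maximal cliques C ≠ D shared two vertices a, b, then for i ∈ C ∖ D and
-- j ∈ D ∖ C the vertices a, b, i, j would induce a diamond unless i ~ j; so C ∪ D
-- is a clique, contradicting maximality.  Hence every edge lies in at most one
-- maximal clique, and without isolated vertices every maximal clique contains an
-- edge, which gives an injection from maximal cliques into edges.

module _ {A B : Set} (R : A → B → Set)
         (R-injective : ∀ {x x′ y} → R x y → R x′ y → x ≡ x′) where

  private
    Any-─ : ∀ {x z ys} → z ≢ x → (p : Any (R x) ys) → Any (R z) ys → Any (R z) (ys ─ p)
    Any-─ z≢x (here Rxy) (here Rzy) = ⊥-elim (z≢x (R-injective Rzy Rxy))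
    Any-─ z≢x (here _)   (there q)  = q
    Any-─ z≢x (there _)  (here Rzy) = here Rzy
    Any-─ z≢x (there p)  (there q)  = there (Any-─ z≢x p q)

  Unique⇒length≤ : ∀ {xs ys} → Unique xs → All (λ x → Any (R x) ys) xs → length xs ≤ length ys
  Unique⇒length≤ []             []       = z≤n
  Unique⇒length≤ {x ∷ xs} {ys} (x≢xs ∷ u) (p ∷ ps) = begin
    suc (length xs)          ≤⟨ s≤s (Unique⇒length≤ u ps′) ⟩
    suc (length (ys ─ p))    ≡⟨ sym (length-removeAt′ ys (index p)) ⟩
    length ys                ∎
    where
    open ≤-Reasoning
    ps′ : All (λ z → Any (R z) (ys ─ p)) xs
    ps′ = All.zipWith (λ (x≢z , q) → Any-─ (≢-sym x≢z) p q) (x≢xs , ps)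

module _ {n} (G : Graph n) where

  Adj-sym : ∀ {i j} → Adj G i j → Adj G j i
  Adj-sym {i} {j} i~j = trans (symm G j i) i~j

  Adj⇒≢ : ∀ {i j} → Adj G i j → i ≢ j
  Adj⇒≢ {i} i~i refl with trans (sym i~i) (irrefl G i)
  ... | ()

  Adj? : ∀ i j → Dec (Adj G i j)
  Adj? i j = adj G i j Bool.≟ true

  pair-isClique : ∀ {x y} → Adj G x y → IsClique G (⁅ x ⁆ ∪ ⁅ y ⁆)
  pair-isClique {x} {y} x~y = (x , x∈p∪q⁺ (inj₁ (x∈⁅x⁆ x))) , pairwise
    where
    pairwise : ∀ i j → i ∈ ⁅ x ⁆ ∪ ⁅ y ⁆ → j ∈ ⁅ x ⁆ ∪ ⁅ y ⁆ → i ≢ j → Adj G i j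
    pairwise i j i∈ j∈ i≢j with x∈p∪q⁻ ⁅ x ⁆ ⁅ y ⁆ i∈ | x∈p∪q⁻ ⁅ x ⁆ ⁅ y ⁆ j∈
    ... | inj₁ i∈x | inj₁ j∈x = ⊥-elim (i≢j (trans (x∈⁅y⁆⇒x≡y x i∈x) (sym (x∈⁅y⁆⇒x≡y x j∈x))))
    ... | inj₂ i∈y | inj₂ j∈y = ⊥-elim (i≢j (trans (x∈⁅y⁆⇒x≡y y i∈y) (sym (x∈⁅y⁆⇒x≡y y j∈y))))
    ... | inj₁ i∈x | inj₂ j∈y rewrite x∈⁅y⁆⇒x≡y x i∈x | x∈⁅y⁆⇒x≡y y j∈y = x~y
    ... | inj₂ i∈y | inj₁ j∈x rewrite x∈⁅y⁆⇒x≡y y i∈y | x∈⁅y⁆⇒x≡y x j∈x = Adj-sym x~y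

  maximalClique-hasEdge : NoIsolatedVertex G → ∀ {C} → IsMaximalClique G C →
                          ∃₂ λ a b → a ∈ C × b ∈ C × Adj G a b
  maximalClique-hasEdge noIsolated {C} (((x , x∈C) , clique) , maximal)
    with any? (λ k → (k ∈? C) ×-dec ¬? (k ≟ᶠ x))
  ... | yes (k , k∈C , k≢x) = x , k , x∈C , k∈C , clique x k x∈C k∈C (≢-sym k≢x)
  ... | no ∄k = ⊥-elim (Adj⇒≢ x~y (sym (onlyX y∈C)))
    where
    y = proj₁ (noIsolated x)
    x~y = proj₂ (noIsolated x)
    onlyX : ∀ {k} → k ∈ C → k ≡ x
    onlyX {k} k∈C = decidable-stable (k ≟ᶠ x) (λ k≢x → ∄k (k , k∈C , k≢x))
    C⊆xy : C ⊆ ⁅ x ⁆ ∪ ⁅ y ⁆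
    C⊆xy k∈C rewrite onlyX k∈C = x∈p∪q⁺ (inj₁ (x∈⁅x⁆ x))
    y∈C : y ∈ C
    y∈C = maximal _ (pair-isClique x~y) C⊆xy (x∈p∪q⁺ (inj₂ (x∈⁅x⁆ y)))

  Covers : Subset n → Fin n × Fin n → Set
  Covers C (a , b) = a ≢ b × a ∈ C × b ∈ C

  module _ (diamondFree : DiamondFree G) where

    private
      ∈∉⇒≢ : ∀ {S : Subset n} {x y} → x ∈ S → y ∉ S → x ≢ y
      ∈∉⇒≢ x∈S y∉S refl = y∉S x∈S

    cliques-covering-pair-adjacent : ∀ {C D e} → IsClique G C → IsClique G D →
      Covers C e → Covers D e → ∀ {i j} → i ∈ C → j ∈ D → i ≢ j → Adj G i j
    cliques-covering-pair-adjacent {C} {D} {a , b} (_ , C-clique) (_ , D-clique)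
      (a≢b , a∈C , b∈C) (_ , a∈D , b∈D) {i} {j} i∈C j∈D i≢j with i ∈? D | j ∈? C
    ... | yes i∈D | _       = D-clique i j i∈D j∈D i≢j
    ... | no _    | yes j∈C = C-clique i j i∈C j∈C i≢j
    ... | no i∉D  | no j∉C  = decidable-stable (Adj? i j) λ i≁j → diamondFree a b i j
      ( a≢b , ∈∉⇒≢ a∈D i∉D , ∈∉⇒≢ a∈C j∉C , ∈∉⇒≢ b∈D i∉D , ∈∉⇒≢ b∈C j∉C , i≢j
      , C-clique a b a∈C b∈C a≢b , C-clique a i a∈C i∈C (∈∉⇒≢ a∈D i∉D)
      , D-clique a j a∈D j∈D (∈∉⇒≢ a∈C j∉C) , C-clique b i b∈C i∈C (∈∉⇒≢ b∈D i∉D)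
      , D-clique b j b∈D j∈D (∈∉⇒≢ b∈C j∉C) , i≁j )

    ∪-isClique : ∀ {C D e} → IsClique G C → IsClique G D →
                 Covers C e → Covers D e → IsClique G (C ∪ D)
    ∪-isClique {C} {D} C-isClique@((x , x∈C) , C-clique) D-isClique@(_ , D-clique) C⊇e D⊇e =
      (x , p⊆p∪q D x∈C) , pairwise
      where
      across = cliques-covering-pair-adjacent C-isClique D-isClique C⊇e D⊇e
      pairwise : ∀ i j → i ∈ C ∪ D → j ∈ C ∪ D → i ≢ j → Adj G i j
      pairwise i j i∈ j∈ i≢j with x∈p∪q⁻ C D i∈ | x∈p∪q⁻ C D j∈
      ... | inj₁ i∈C | inj₁ j∈C = C-clique i j i∈C j∈C i≢j
      ... | inj₂ i∈D | inj₂ j∈D = D-clique i j i∈D j∈D i≢j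
      ... | inj₁ i∈C | inj₂ j∈D = across i∈C j∈D i≢j
      ... | inj₂ i∈D | inj₁ j∈C = Adj-sym (across j∈C i∈D (≢-sym i≢j))

    maximalClique-unique : ∀ {C D e} → IsMaximalClique G C → IsMaximalClique G D →
                           Covers C e → Covers D e → C ≡ D
    maximalClique-unique {C} {D} (C-isClique , C-maximal) (D-isClique , D-maximal) C⊇e D⊇e =
      ⊆-antisym (λ x∈C → D-maximal _ C∪D (q⊆p∪q C D) (p⊆p∪q D x∈C))
                (λ x∈D → C-maximal _ C∪D (p⊆p∪q D) (q⊆p∪q C D x∈D))
      where
      C∪D = ∪-isClique C-isClique D-isClique C⊇e D⊇e

  -- edgeCount G is, by definition, the length of this list.
  edges : List (Fin n × Fin n)
  edges = filter (λ (i , j) → ((toℕ i <ᵇ toℕ j) ∧ adj G i j) Bool.≟ true)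
                 (concatMap (λ i → map (i ,_) (allFin n)) (allFin n))

  ∈-edges : ∀ {i j} → toℕ i < toℕ j → Adj G i j → (i , j) ∈ˡ edges
  ∈-edges {i} {j} i<j i~j = ∈-filter⁺ _
    (∈-concatMap⁺ (λ i → map (i ,_) (allFin n))
      (Any.map (λ { refl → ∈-map⁺ (i ,_) (∈-allFin j) }) (∈-allFin i)))
    (Equivalence.to T-≡ (Equivalence.from T-∧ (<⇒<ᵇ i<j , Equivalence.from T-≡ i~j)))

  Adj⇒∈-edges : ∀ {i j} → Adj G i j → (i , j) ∈ˡ edges ⊎ (j , i) ∈ˡ edges
  Adj⇒∈-edges {i} {j} i~j with <-cmp (toℕ i) (toℕ j)
  ... | tri< i<j _ _ = inj₁ (∈-edges i<j i~j)
  ... | tri≈ _ i≡j _ = ⊥-elim (Adj⇒≢ i~j (toℕ-injective i≡j))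
  ... | tri> _ _ j<i = inj₂ (∈-edges j<i (Adj-sym i~j))

  MaximalCliqueCovering : Subset n → Fin n × Fin n → Set
  MaximalCliqueCovering C e = IsMaximalClique G C × Covers C e

  maximalClique-coversEdge : NoIsolatedVertex G → ∀ {C} → IsMaximalClique G C →
                             Any (MaximalCliqueCovering C) edges
  maximalClique-coversEdge noIsolated C-maximal
    with a , b , a∈C , b∈C , a~b ← maximalClique-hasEdge noIsolated C-maximal
    with Adj⇒∈-edges a~b
  ... | inj₁ ab∈edges = lose ab∈edges (C-maximal , Adj⇒≢ a~b , a∈C , b∈C)
  ... | inj₂ ba∈edges = lose ba∈edges (C-maximal , Adj⇒≢ (Adj-sym a~b) , b∈C , a∈C)

corollary1 : ∀ {n} (G : Graph n) → DiamondFree G → NoIsolatedVertex G →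
    (Cs : List (Subset n)) → Unique Cs → All (IsMaximalClique G) Cs →
    length Cs ≤ edgeCount G
corollary1 G diamondFree noIsolated Cs unique maximal =
  Unique⇒length≤ (MaximalCliqueCovering G) covering-injective unique
    (All.map (maximalClique-coversEdge G noIsolated) maximal)
  where
  covering-injective : ∀ {C D e} → MaximalCliqueCovering G C e → MaximalCliqueCovering G D e → C ≡ D
  covering-injective (C-maximal , C⊇e) (D-maximal , D⊇e) =
    maximalClique-unique G diamondFree C-maximal D-maximal C⊇e D⊇e
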